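{- An $(\varepsilon,I_\bullet,J_\circ)$-forest $F$ lies on the boundary of the $(\varepsilon,I_\bullet,J_\circ)$-complex if and only if there exist an $(\varepsilon,I_\bullet,J_\circ)$-tree $T$ and an unflippable edge $\delta$ of $T$ such that $F\subseteq T\setminus\{\delta\}$. In particular, every $(\varepsilon,I_\bullet,J_\circ)$-forest that does not contain some irrelevant edge of $G$, or that has some vertex of $I_\bullet\cup J_\circ$ incident to none of its edges, lies on the boundary of the $(\varepsilon,I_\bullet,J_\circ)$-complex.
   Context: Fix an integer $n\ge 1$ and $\varepsilon\in\{+,-\}^n$. Black vertices are $0_\bullet,\dots,n_\bullet$, white vertices $1_\circ,\dots,(n+1)_\circ$, compared through their integer indices. Let $P_\varepsilon$ be a convex $(2n+2)$-gon in $\mathbb{R}^2$ whose vertices, in strictly increasing $x$-order, are $0_\bullet,1_\circ,1_\bullet,\dots,n_\circ,n_\bullet,(n+1)_\circ$, with $k_\circ,k_\bullet$ strictly above the line through $0_\bullet$ and $(n+1)_\circ$ if $\varepsilon_k=+$ and strictly below if $\varepsilon_k=-$ ($1\le k\le n$). Let $I_\bullet\subseteq\{0_\bullet,\dots,n_\bullet\}$, $J_\circ\subseteq\{1_\circ,\dots,(n+1)_\circ\}$ be nonempty with $\min(I_\bullet)<\min(J_\circ)$ and $\max(I_\bullet)<\max(J_\circ)$. Let $G$ be the geometric graph on $I_\bullet\cup J_\circ$ with a straight edge $(i_\bullet,j_\circ)$ for each $i_\bullet\in I_\bullet,j_\circ\in J_\circ$ with $i<j$. Two edges cross if they meet at a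 point interior to both. An edge of $G$ is irrelevant if no other edge of $G$ crosses it. An $(\varepsilon,I_\bullet,J_\circ)$-forest is a set of pairwise non-crossing edges of $G$; an $(\varepsilon,I_\bullet,J_\circ)$-tree is an inclusion-maximal forest. The $(\varepsilon,I_\bullet,J_\circ)$-complex is the simplicial complex on the edges of $G$ whose faces are the forests; it is a pseudomanifold whose facets are the trees. An edge $\delta$ of a tree $T$ is flippable if there exist a tree $T'\ne T$ and $\delta'\in T'$ with $T\setminus\{\delta\}=T'\setminus\{\delta'\}$, and unflippable otherwise. A face lies on the boundary of the complex if it is contained in a codimension-one face (a set $T\setminus\{\delta\}$ with $T$ a tree and $\delta\in T$) that is contained in exactly one facet. -}

module Defs where

open import Data.Nat using (ℕ; zero; suc; _+_; _*_; _∸_; _<_; _<?_)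
open import Data.Fin using (Fin; zero; suc; toℕ; fromℕ<)
open import Data.Fin.Subset using (Subset; _∈_)
open import Data.Bool using (Bool; true; false)
open import Data.Product using (Σ; ∃; ∃-syntax; _×_; _,_)
open import Data.Sum using (_⊎_)
open import Relation.Nullary using (¬_; yes; no)
open import Relation.Binary.PropositionalEquality using (_≡_; _≢_)

data Sign : Set where
  plus minus : Sign

SignVec : ℕ → Set
SignVec n = Fin n → Sign

-- Black vertex  i_•  (0 ≤ i ≤ n)      is represented by  b : Fin (suc n)  with i = toℕ b.
-- White vertex  j_∘  (1 ≤ j ≤ n+1)    is represented by  w : Fin (suc n)  with j = suc (toℕ w).

blackIdx : ∀ {n} → Fin (suc n) → ℕ
blackIdx b = toℕ b

whiteIdx : ∀ {n} → Fin (suc n) → ℕ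
whiteIdx w = suc (toℕ w)

-- Position of a vertex in the counter-clockwise cyclic order of the
-- convex polygon P_ε, as a natural number in 0 .. 4n+1:
--   0_•                    ↦ 0
--   vertex below the line  ↦ its x-rank p  (x-ranks: k_∘ ↦ 2k-1, k_• ↦ 2k)
--   (n+1)_∘                ↦ 2n+1
--   vertex above the line  ↦ 4n+2 ∸ p
-- (lower chain left-to-right, then upper chain right-to-left).
signed : ℕ → Sign → ℕ → ℕ
signed n minus p = p
signed n plus  p = (4 * n + 2) ∸ p

rankB : ∀ {n} → SignVec n → Fin (suc n) → ℕ
rankB {n} ε zero    = 0
rankB {n} ε (suc k) = signed n (ε k) (2 * suc (toℕ k))

rankW : ∀ {n} → SignVec n → Fin (suc n) → ℕ
rankW {n} ε w with toℕ w <? n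
... | yes p = signed n (ε (fromℕ< p)) (2 * toℕ w + 1)
... | no  _ = 2 * n + 1

-- Potential edges (i_•, j_∘) : a black vertex and a white vertex.
Edge : ℕ → Set
Edge n = Fin (suc n) × Fin (suc n)

IsEdge : ∀ {n} → Subset (suc n) → Subset (suc n) → Edge n → Set
IsEdge I J (b , w) = (b ∈ I) × (w ∈ J) × (blackIdx b < whiteIdx w)

Between : ℕ → ℕ → ℕ → Set
Between x y z = (x < z × z < y) ⊎ (y < z × z < x)

-- Two straight chords of the strictly convex polygon P_ε meet at a point
-- interior to both iff their four endpoints are distinct and interleave
-- in the cyclic order.
Cross : ∀ {n} → SignVec n → Edge n → Edge n → Set
Cross ε (a , b) (c , d) =
  a ≢ c × b ≢ d ×
  ( (Between (rankB ε a) (rankW ε b) (rankB ε c) × ¬ Between (rankB ε a) (rankW ε b) (rankW ε d))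
  ⊎ (¬ Between (rankB ε a) (rankW ε b) (rankB ε c) × Between (rankB ε a) (rankW ε b) (rankW ε d)))

EdgeSet : ℕ → Set
EdgeSet n = Edge n → Bool

_∈ₑ_ : ∀ {n} → Edge n → EdgeSet n → Set
e ∈ₑ S = S e ≡ true

_⊆ₑ_ : ∀ {n} → EdgeSet n → EdgeSet n → Set
S ⊆ₑ T = ∀ e → e ∈ₑ S → e ∈ₑ T

_≐ₑ_ : ∀ {n} → EdgeSet n → EdgeSet n → Set
S ≐ₑ T = (S ⊆ₑ T) × (T ⊆ₑ S)

_∖ₑ_ : ∀ {n} → EdgeSet n → Edge n → EdgeSet n
(T ∖ₑ δ) e = T e Data.Bool.∧ Data.Bool.not (eqEdge e δ)
  where
  open import Data.Fin using (_≟_)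
  open import Relation.Nullary.Decidable using (⌊_⌋)
  eqEdge : _ → _ → Bool
  eqEdge (a , b) (c , d) = ⌊ a ≟ c ⌋ Data.Bool.∧ ⌊ b ≟ d ⌋

module Complex {n : ℕ} (ε : SignVec n) (I J : Subset (suc n)) where

  Forest : EdgeSet n → Set
  Forest F = (∀ e → e ∈ₑ F → IsEdge I J e)
           × (∀ e f → e ∈ₑ F → f ∈ₑ F → ¬ Cross ε e f)

  Tree : EdgeSet n → Set
  Tree T = Forest T × (∀ F → Forest F → T ⊆ₑ F → F ⊆ₑ T)

  Flippable : EdgeSet n → Edge n → Set
  Flippable T δ = ∃[ T' ] ∃[ δ' ] (Tree T' × ¬ (T' ≐ₑ T) × δ' ∈ₑ T' × ((T ∖ₑ δ) ≐ₑ (T' ∖ₑ δ')))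

  Unflippable : EdgeSet n → Edge n → Set
  Unflippable T δ = ¬ Flippable T δ

  CodimOne : EdgeSet n → Set
  CodimOne C = ∃[ T ] ∃[ δ ] (Tree T × δ ∈ₑ T × (C ≐ₑ (T ∖ₑ δ)))

  InExactlyOneFacet : EdgeSet n → Set
  InExactlyOneFacet C = ∃[ T ] (Tree T × C ⊆ₑ T × (∀ T' → Tree T' → C ⊆ₑ T' → T' ≐ₑ T))

  OnBoundary : EdgeSet n → Set
  OnBoundary F = ∃[ C ] (CodimOne C × InExactlyOneFacet C × F ⊆ₑ C)

  Irrelevant : Edge n → Set
  Irrelevant δ = IsEdge I J δ × (∀ e → IsEdge I J e → ¬ Cross ε e δ)

  HasIsolatedVertex : EdgeSet n → Set
  HasIsolatedVertex F =
      (∃[ i ] (i ∈ I × (∀ e → e ∈ₑ F → Data.Product.proj₁ e ≢ i)))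
    ⊎ (∃[ j ] (j ∈ J × (∀ e → e ∈ₑ F → Data.Product.proj₂ e ≢ j)))

Admissible : ∀ {n} → Subset (suc n) → Subset (suc n) → Set
Admissible I J =
    (∃[ i ] i ∈ I) × (∃[ j ] j ∈ J)
  × (∃[ i ] (i ∈ I × (∀ j → j ∈ J → blackIdx i < whiteIdx j)))   -- min I < min J
  × (∃[ j ] (j ∈ J × (∀ i → i ∈ I → blackIdx i < whiteIdx j)))   -- max I < max J

module Submission where

-- Two chords of the convex polygon P_ε cross iff their endpoints interleave in the cyclic order of
-- the vertices, so every geometric fact needed below concerns the relative order of at most six
-- positions and is checked by evaluation on all order types; the only genuinely metric input is
-- that a vertical line through a vertex separates the chords on its two sides.
--
-- If T ∖ δ lies in a second tree T′, each edge of T′ ∖ T crosses δ, and two of them would force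
-- one of four "mixed" edges, which can neither lie in T (it crosses T′) nor be blocked by T
-- (its blocker would cross δ or T′). Hence T′ = (T ∖ δ) ∪ {δ′}: T ∖ δ lies in a unique tree
-- exactly when δ is unflippable.
--
-- For the second part, let Q be a set of pairwise non-crossing edges that F avoids and every
-- tree meets: the missing irrelevant edge, or all edges at the isolated vertex (a tree has an
-- edge at each vertex, since rotating an edge at v onto an endpoint of a tree edge crossing it
-- lowers its number of crossings). Extend F to a forest maximal among those avoiding Q, then to
-- a tree T, and take δ ∈ T ∩ Q. A flip δ′ of δ would be compatible with T if δ′ ∈ Q, and with
-- the maximal forest otherwise, so it would already lie in T.

open import Defs
open import Level using (0ℓ)
open import Data.Nat using (ℕ; zero; suc; _+_; _*_; _∸_; _<_; _≤_; z≤n; s≤s; s≤s⁻¹)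
open import Data.Nat.Properties
open import Data.Nat.Induction using (<-wellFounded)
open import Data.Nat.Solver using (module +-*-Solver)
open import Data.Bool using (Bool; true; false; T; not; _∧_; _∨_)
import Data.Bool as Bool
open import Data.Bool.Properties using (∧-zeroʳ; ∨-zeroʳ)
open import Data.Fin using (Fin; zero; suc; #_; toℕ; fromℕ<)
open import Data.Fin.Properties using (toℕ-injective; toℕ≤pred[n])
import Data.Fin.Properties as Fin
open import Data.Fin.Subset using (Subset)
import Data.Fin.Subset as Subset
open import Data.Fin.Subset.Properties using (_∈?_)
open import Data.Unit using (tt)
open import Data.Empty using (⊥; ⊥-elim)
open import Data.Product using (_×_; _,_; proj₁; proj₂; ∃; ∃-syntax; swap)
open import Data.Product.Properties using (≡-dec)
open import Data.Sum using (_⊎_; inj₁; inj₂; [_,_])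
import Data.Sum as Sum
open import Data.List using (List; []; _∷_)
import Data.List as List
import Data.List.Relation.Unary.All as ListAll
import Data.List.Relation.Unary.All.Properties as ListAllₚ
open import Data.Vec using (Vec; []; _∷_; lookup; tabulate; count; allFin; allPairs)
open import Data.Vec.Properties using (tabulate-cong; lookup∘tabulate; count≤n)
open import Data.Vec.Relation.Unary.All using (All; []; _∷_)
open import Data.Vec.Relation.Unary.All.Properties using (tabulate⁺)
open import Data.Vec.Relation.Unary.Any using (here; there)
open import Data.Vec.Membership.Propositional using (_∈_)
open import Data.Vec.Membership.Propositional.Properties using (∈-lookup; ∈-allFin⁺; ∈-allPairs⁺)
open import Function using (_∘_; _⇔_; mk⇔)
open import Induction.WellFounded using (Acc; acc)
open import Relation.Binary using (Rel; Decidable; DecidableEquality; tri<; tri≈; tri>)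
open import Relation.Binary.PropositionalEquality using (_≡_; _≢_; refl; sym; trans; cong; cong₂; subst; module ≡-Reasoning)
open import Relation.Unary as U using (Pred)
open import Relation.Nullary using (¬_; Dec; yes; no; does; ¬?; _×-dec_; _⊎-dec_; _→-dec_; contradiction)
open import Relation.Nullary.Decidable using (map′; does-⇔; T?; ⌊_⌋; decidable-stable)

module _ {A : Set} {P Q : Pred A 0ℓ} (P? : U.Decidable P) (Q? : U.Decidable Q) (P⇒Q : ∀ {x} → P x → Q x) where

  count-mono : ∀ {k} (xs : Vec A k) → count P? xs ≤ count Q? xs
  count-mono [] = z≤n
  count-mono (x ∷ xs) with P? x | Q? x
  ... | yes _ | yes _ = s≤s (count-mono xs)
  ... | yes p | no ¬q = contradiction (P⇒Q p) ¬q
  ... | no _  | yes _ = m≤n⇒m≤1+n (count-mono xs)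
  ... | no _  | no _  = count-mono xs

  count-mono-strict : ∀ {k x} {xs : Vec A k} → x ∈ xs → ¬ P x → Q x → count P? xs < count Q? xs
  count-mono-strict {x = x} {x ∷ xs} (here refl) ¬p q with P? x | Q? x
  ... | yes p | _     = contradiction p ¬p
  ... | no _  | yes _ = s≤s (count-mono xs)
  ... | no _  | no ¬q = contradiction q ¬q
  count-mono-strict {xs = y ∷ xs} (there x∈xs) ¬p q with P? y | Q? y
  ... | yes _ | yes _ = s≤s (count-mono-strict x∈xs ¬p q)
  ... | yes p | no ¬q = contradiction (P⇒Q p) ¬q
  ... | no _  | yes _ = m≤n⇒m≤1+n (count-mono-strict x∈xs ¬p q)
  ... | no _  | no _  = count-mono-strict x∈xs ¬p q

module _ {A : Set} {P : Pred A 0ℓ} (P? : U.Decidable P) where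

  count<length : ∀ {k x} {xs : Vec A k} → x ∈ xs → ¬ P x → count P? xs < k
  count<length {x = x} {x ∷ xs} (here refl) ¬p with P? x
  ... | yes p = contradiction p ¬p
  ... | no _  = s≤s (count≤n P? xs)
  count<length {xs = y ∷ xs} (there x∈xs) ¬p with P? y
  ... | yes _ = s≤s (count<length x∈xs ¬p)
  ... | no _  = m≤n⇒m≤1+n (count<length x∈xs ¬p)

witness : ∀ {A : Set} (a? : Dec A) → T (does a?) → A
witness (yes a) _ = a

Comparison : ℕ → Set
Comparison m = Fin m → Fin m → Bool

-- Tabulated, so that vectors with the same comparisons have ≡ order types without function extensionality.
comparisonTable : ∀ {m} → Vec ℕ m → Vec (Vec Bool m) m
comparisonTable v = tabulate λ i → tabulate λ j → does (lookup v i <? lookup v j)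

orderType : ∀ {m} → Vec ℕ m → Comparison m
orderType v i j = lookup (lookup (comparisonTable v) i) j

compress : ∀ {m} → Vec ℕ m → Vec ℕ m
compress v = tabulate λ i → count (_<? lookup v i) v

module _ {m} (v : Vec ℕ m) where
  count-<-⇔ : ∀ {x y} → x ∈ v → count (_<? x) v < count (_<? y) v ⇔ x < y
  count-<-⇔ {x} {y} x∈v = mk⇔ from to
    where
    to : x < y → count (_<? x) v < count (_<? y) v
    to x<y = count-mono-strict (_<? x) (_<? y) (λ z<x → <-trans z<x x<y) x∈v (<-irrefl refl) x<y
    from : count (_<? x) v < count (_<? y) v → x < y
    from r with x <? y
    ... | yes x<y = x<y
    ... | no x≮y = contradiction r (≤⇒≯ (count-mono (_<? y) (_<? x) (λ z<y → <-≤-trans z<y (≮⇒≥ x≮y)) v))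

  compress-table : comparisonTable (compress v) ≡ comparisonTable v
  compress-table = tabulate-cong λ i → tabulate-cong λ j → begin
    does (lookup (compress v) i <? lookup (compress v) j)
      ≡⟨ cong₂ (λ a b → does (a <? b)) (lookup∘tabulate _ i) (lookup∘tabulate _ j) ⟩
    does (count (_<? lookup v i) v <? count (_<? lookup v j) v)
      ≡⟨ does-⇔ (count-<-⇔ (∈-lookup i v))
                (count (_<? lookup v i) v <? count (_<? lookup v j) v) (lookup v i <? lookup v j) ⟩
    does (lookup v i <? lookup v j) ∎
    where open ≡-Reasoning

  compress-bounded : All (_< m) (compress v)
  compress-bounded = tabulate⁺ λ i → count<length (_<? lookup v i) (∈-lookup i v) (<-irrefl refl)

∀-bounded? : ∀ b k {P : Pred (Vec ℕ k) 0ℓ} → U.Decidable P → Dec (∀ {v} → All (_< b) v → P v)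
∀-bounded? b zero P? = map′ (λ p → λ { [] → p }) (λ h → h []) (P? [])
∀-bounded? b (suc k) P? =
  map′ (λ h → λ { (x<b ∷ xs<b) → h x<b xs<b }) (λ h {x} x<b {xs} xs<b → h {x ∷ xs} (x<b ∷ xs<b))
    (allUpTo? (λ x → ∀-bounded? b k (λ xs → P? (x ∷ xs))) b)

-- compress v has the order type of v and entries below m, so the check covers every v.
orderTypes-sound : ∀ m (Φ : Comparison m → Bool) → T (does (∀-bounded? m m (λ w → T? (Φ (orderType w))))) →
                   ∀ v → T (Φ (orderType v))
orderTypes-sound m Φ check v = subst (λ t → T (Φ (λ i j → lookup (lookup t i) j))) (compress-table v)
  (witness (∀-bounded? m m (λ w → T? (Φ (orderType w)))) check (compress-bounded v))

module Interleaving {A : Set} {_≺_ : Rel A 0ℓ} (_≺?_ : Decidable _≺_) where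

  Apart : Rel A 0ℓ
  Apart x y = x ≺ y ⊎ y ≺ x

  Inside : A → A → A → Set
  Inside x y z = (x ≺ z × z ≺ y) ⊎ (y ≺ z × z ≺ x)

  Interleaved : A → A → A → A → Set
  Interleaved a b c d =
    Apart a c × Apart b d × ((Inside a b c × ¬ Inside a b d) ⊎ (¬ Inside a b c × Inside a b d))

  ApartAll : List A → List A → Set
  ApartAll xs ys = ListAll.All (λ x → ListAll.All (Apart x) ys) xs

  apart? : Decidable Apart
  apart? x y = (x ≺? y) ⊎-dec (y ≺? x)

  inside? : ∀ x y z → Dec (Inside x y z)
  inside? x y z = ((x ≺? z) ×-dec (z ≺? y)) ⊎-dec ((y ≺? z) ×-dec (z ≺? x))

  interleaved? : ∀ a b c d → Dec (Interleaved a b c d)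
  interleaved? a b c d = apart? a c ×-dec apart? b d ×-dec
    ((inside? a b c ×-dec ¬? (inside? a b d)) ⊎-dec (¬? (inside? a b c) ×-dec inside? a b d))

  apartAll? : ∀ xs ys → Dec (ApartAll xs ys)
  apartAll? xs ys = ListAll.all? (λ x → ListAll.all? (apart? x) ys) xs

  Symmetric : A → A → A → A → Set
  Symmetric a b c d = ApartAll (a ∷ c ∷ []) (b ∷ d ∷ []) → Interleaved a b c d → Interleaved c d a b

  symmetric? : ∀ a b c d → Dec (Symmetric a b c d)
  symmetric? a b c d = apartAll? (a ∷ c ∷ []) (b ∷ d ∷ []) →-dec interleaved? a b c d →-dec interleaved? c d a b

  Fan : A → A → A → A → A → A → Set
  Fan p q r s x y = ApartAll (p ∷ r ∷ x ∷ []) (q ∷ s ∷ y ∷ []) →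
    Interleaved p q r s → Interleaved x y p s → Interleaved x y p q ⊎ Interleaved x y r s

  fan? : ∀ p q r s x y → Dec (Fan p q r s x y)
  fan? p q r s x y = apartAll? (p ∷ r ∷ x ∷ []) (q ∷ s ∷ y ∷ []) →-dec
    interleaved? p q r s →-dec interleaved? x y p s →-dec (interleaved? x y p q ⊎-dec interleaved? x y r s)

  Exchange : A → A → A → A → A → A → Set
  Exchange p q r₁ s₁ r₂ s₂ = ApartAll (p ∷ r₁ ∷ r₂ ∷ []) (q ∷ s₁ ∷ s₂ ∷ []) →
    Interleaved p q r₁ s₁ → Interleaved p q r₂ s₂ → ¬ Interleaved r₁ s₁ r₂ s₂ → Apart r₁ r₂ ⊎ Apart s₁ s₂ →
    Interleaved p s₁ r₂ s₂ ⊎ Interleaved p s₂ r₁ s₁ ⊎ Interleaved r₁ q r₂ s₂ ⊎ Interleaved r₂ q r₁ s₁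

  exchange? : ∀ p q r₁ s₁ r₂ s₂ → Dec (Exchange p q r₁ s₁ r₂ s₂)
  exchange? p q r₁ s₁ r₂ s₂ = apartAll? (p ∷ r₁ ∷ r₂ ∷ []) (q ∷ s₁ ∷ s₂ ∷ []) →-dec
    interleaved? p q r₁ s₁ →-dec interleaved? p q r₂ s₂ →-dec ¬? (interleaved? r₁ s₁ r₂ s₂) →-dec
    (apart? r₁ r₂ ⊎-dec apart? s₁ s₂) →-dec
    (interleaved? p s₁ r₂ s₂ ⊎-dec interleaved? p s₂ r₁ s₁ ⊎-dec interleaved? r₁ q r₂ s₂ ⊎-dec interleaved? r₂ q r₁ s₁)

module OrderType {m} (lt : Comparison m) = Interleaving {Fin m} {λ i j → T (lt i j)} (λ i j → T? (lt i j))

open Interleaving _<?_ using (Apart; Interleaved; ApartAll; interleaved?; Symmetric; symmetric?; Fan; fan?; Exchange; exchange?)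

-- On the order type of A ∷ B ∷ C ∷ D ∷ [], OrderType.symmetric? evaluates to the same Boolean as
-- symmetric? A B C D, so the exhaustive check applies directly; likewise for fan and exchange.
interleaved-sym : ∀ A B C D → Symmetric A B C D
interleaved-sym A B C D = witness (symmetric? A B C D)
  (orderTypes-sound 4 (λ lt → does (OrderType.symmetric? lt (# 0) (# 1) (# 2) (# 3))) _ (A ∷ B ∷ C ∷ D ∷ []))

interleaved-fan : ∀ p q r s x y → Fan p q r s x y
interleaved-fan p q r s x y = witness (fan? p q r s x y)
  (orderTypes-sound 6 (λ lt → does (OrderType.fan? lt (# 0) (# 1) (# 2) (# 3) (# 4) (# 5))) _
    (p ∷ q ∷ r ∷ s ∷ x ∷ y ∷ []))

interleaved-exchange : ∀ p q r₁ s₁ r₂ s₂ → Exchange p q r₁ s₁ r₂ s₂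
interleaved-exchange p q r₁ s₁ r₂ s₂ = witness (exchange? p q r₁ s₁ r₂ s₂)
  (orderTypes-sound 6 (λ lt → does (OrderType.exchange? lt (# 0) (# 1) (# 2) (# 3) (# 4) (# 5))) _
    (p ∷ q ∷ r₁ ∷ s₁ ∷ r₂ ∷ s₂ ∷ []))

apart-irrefl : ∀ {x} → ¬ Apart x x
apart-irrefl = [ <-irrefl refl , <-irrefl refl ]

≢⇒apart : ∀ {x y} → x ≢ y → Apart x y
≢⇒apart {x} {y} x≢y with <-cmp x y
... | tri< x<y _ _ = inj₁ x<y
... | tri≈ _ x≡y _ = contradiction x≡y x≢y
... | tri> _ _ y<x = inj₂ y<x

odd<even : ∀ {a b} → a < b → 2 * a + 1 < 2 * b
odd<even {a} {b} a<b = ≤-trans (≤-reflexive (suc[2a+1]≡2[1+a] a)) (*-monoʳ-≤ 2 a<b)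
  where
  open +-*-Solver
  suc[2a+1]≡2[1+a] : ∀ a → suc (2 * a + 1) ≡ 2 * suc a
  suc[2a+1]≡2[1+a] = solve 1 (λ a → con 1 :+ (con 2 :* a :+ con 1) := con 2 :* (con 1 :+ a)) refl

module Ranks {n : ℕ} (ε : SignVec n) where

  M N : ℕ
  M = 2 * n + 1
  N = 4 * n + 2

  N≡M+M : N ≡ M + M
  N≡M+M = solve 1 (λ k → con 4 :* k :+ con 2 := (con 2 :* k :+ con 1) :+ (con 2 :* k :+ con 1)) refl n
    where
    open +-*-Solver

  M≤N : M ≤ N
  M≤N = ≤-trans (m≤m+n M M) (≤-reflexive (sym N≡M+M))

  xB xW : Fin (suc n) → ℕ
  xB b = 2 * toℕ b
  xW w = 2 * toℕ w + 1

  xB≤M : ∀ b → xB b ≤ M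
  xB≤M b = ≤-trans (*-monoʳ-≤ 2 (toℕ≤pred[n] b)) (m≤m+n (2 * n) 1)

  xW≤M : ∀ w → xW w ≤ M
  xW≤M w = +-monoˡ-≤ 1 (*-monoʳ-≤ 2 (toℕ≤pred[n] w))

  -- xB, xW are the x-ranks 2k of k_• and 2k − 1 of k_∘; a vertex of x-rank x sits at cyclic
  -- position x on the lower chain or N ∸ x on the upper one.
  Placed : ℕ → ℕ → Set
  Placed x r = r ≡ x ⊎ r ≡ N ∸ x

  rankB-placed : ∀ b → Placed (xB b) (rankB ε b)
  rankB-placed zero = inj₁ refl
  rankB-placed (suc k) with ε k
  ... | plus  = inj₂ refl
  ... | minus = inj₁ refl

  rankW-placed : ∀ w → Placed (xW w) (rankW ε w)
  rankW-placed w with toℕ w <? n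
  ... | yes w<n with ε (fromℕ< w<n)
  ...   | plus  = inj₂ refl
  ...   | minus = inj₁ refl
  rankW-placed w | no w≮n = inj₁ (cong (λ k → 2 * k + 1) (≤-antisym (≮⇒≥ w≮n) (toℕ≤pred[n] w)))

  sum-at-top : ∀ {x y} → x ≤ M → y ≤ M → x + y ≡ N → x ≡ M
  sum-at-top {x} {y} x≤M y≤M x+y≡N =
    ≤-antisym x≤M (+-cancelʳ-≤ M M x (≤-trans (≤-reflexive (trans (sym N≡M+M) (sym x+y≡N))) (+-monoʳ-≤ x y≤M)))

  folded-injective : ∀ {x y} → x ≤ M → y ≤ M → x ≡ N ∸ y → x ≡ y
  folded-injective {x} {y} x≤M y≤M x≡N∸y = trans (sum-at-top x≤M y≤M x+y≡N) (sym (sum-at-top y≤M x≤M y+x≡N))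
    where
    x+y≡N : x + y ≡ N
    x+y≡N = trans (cong (_+ y) x≡N∸y) (m∸n+n≡m (≤-trans y≤M M≤N))
    y+x≡N : y + x ≡ N
    y+x≡N = trans (+-comm y x) x+y≡N

  placed-injective : ∀ {x y r} → x ≤ M → y ≤ M → Placed x r → Placed y r → x ≡ y
  placed-injective x≤M y≤M (inj₁ refl) (inj₁ r≡y)   = r≡y
  placed-injective x≤M y≤M (inj₁ refl) (inj₂ r≡N∸y) = folded-injective x≤M y≤M r≡N∸y
  placed-injective x≤M y≤M (inj₂ r≡N∸x) (inj₁ refl) = sym (folded-injective y≤M x≤M r≡N∸x)
  placed-injective x≤M y≤M (inj₂ refl) (inj₂ r≡N∸y) =
    ∸-cancelˡ-≡ (≤-trans x≤M M≤N) (≤-trans y≤M M≤N) r≡N∸y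

  rankB-injective : ∀ {a c} → rankB ε a ≡ rankB ε c → a ≡ c
  rankB-injective {a} {c} eq = toℕ-injective (*-cancelˡ-≡ (toℕ a) (toℕ c) 2
    (placed-injective (xB≤M a) (xB≤M c) (rankB-placed a) (subst (Placed (xB c)) (sym eq) (rankB-placed c))))

  rankW-injective : ∀ {w z} → rankW ε w ≡ rankW ε z → w ≡ z
  rankW-injective {w} {z} eq = toℕ-injective (*-cancelˡ-≡ (toℕ w) (toℕ z) 2 (+-cancelʳ-≡ 1 _ _
    (placed-injective (xW≤M w) (xW≤M z) (rankW-placed w) (subst (Placed (xW z)) (sym eq) (rankW-placed z)))))

  rankB≢rankW : ∀ b w → rankB ε b ≢ rankW ε w
  rankB≢rankW b w eq = even≢odd (toℕ b) (toℕ w) (trans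
    (placed-injective (xB≤M b) (xW≤M w) (rankB-placed b) (subst (Placed (xW w)) (sym eq) (rankW-placed w)))
    (+-comm (2 * toℕ w) 1))

  -- The vertical line at x-rank c meets the boundary of the polygon at the positions c and N ∸ c.
  Band Outside : ℕ → ℕ → Set
  Band c r = c ≤ r × r ≤ N ∸ c
  Outside c r = r < c ⊎ N ∸ c < r

  placed-right : ∀ {c x r} → c ≤ x → x ≤ M → Placed x r → Band c r
  placed-right {c} {x} c≤x x≤M (inj₁ refl) =
    c≤x , m+n≤o⇒m≤o∸n x (≤-trans (+-mono-≤ x≤M (≤-trans c≤x x≤M)) (≤-reflexive (sym N≡M+M)))
  placed-right {c} {x} c≤x x≤M (inj₂ refl) =
    m+n≤o⇒m≤o∸n c (≤-trans (+-mono-≤ (≤-trans c≤x x≤M) x≤M) (≤-reflexive (sym N≡M+M))) , ∸-monoʳ-≤ N c≤x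

  placed-left : ∀ {c x r} → x < c → c ≤ M → Placed x r → Outside c r
  placed-left x<c c≤M (inj₁ refl) = inj₁ x<c
  placed-left x<c c≤M (inj₂ refl) = inj₂ (∸-monoʳ-< x<c (≤-trans c≤M M≤N))

  not-inside : ∀ {c p q z} → Band c p → Band c q → Outside c z → ¬ Between p q z
  not-inside (c≤p , _) _ (inj₁ z<c) (inj₁ (p<z , _)) = <-asym z<c (≤-<-trans c≤p p<z)
  not-inside _ (_ , q≤N∸c) (inj₂ N∸c<z) (inj₁ (_ , z<q)) = <-asym N∸c<z (<-≤-trans z<q q≤N∸c)
  not-inside _ (c≤q , _) (inj₁ z<c) (inj₂ (q<z , _)) = <-asym z<c (≤-<-trans c≤q q<z)
  not-inside (_ , p≤N∸c) _ (inj₂ N∸c<z) (inj₂ (_ , z<p)) = <-asym N∸c<z (<-≤-trans z<p p≤N∸c)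

module Geometry {n : ℕ} (ε : SignVec n) where
  open Ranks ε

  ranks-apart : ∀ bs ws → ApartAll (List.map (rankB ε) bs) (List.map (rankW ε) ws)
  ranks-apart bs ws =
    ListAllₚ.map⁺ (ListAll.universal (λ b → ListAllₚ.map⁺ (ListAll.universal (λ w → ≢⇒apart (rankB≢rankW b w)) ws)) bs)

  cross⇒interleaved : ∀ {a b c d} → Cross ε (a , b) (c , d) →
                      Interleaved (rankB ε a) (rankW ε b) (rankB ε c) (rankW ε d)
  cross⇒interleaved (a≢c , b≢d , sides) =
    ≢⇒apart (a≢c ∘ rankB-injective) , ≢⇒apart (b≢d ∘ rankW-injective) , sides

  interleaved⇒cross : ∀ {a b c d} → Interleaved (rankB ε a) (rankW ε b) (rankB ε c) (rankW ε d) →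
                      Cross ε (a , b) (c , d)
  interleaved⇒cross (a#c , b#d , sides) = (λ { refl → apart-irrefl a#c }) , (λ { refl → apart-irrefl b#d }) , sides

  cross-irrefl : ∀ {e} → ¬ Cross ε e e
  cross-irrefl (a≢a , _) = a≢a refl

  cross-sym : ∀ {e f} → Cross ε e f → Cross ε f e
  cross-sym {a , b} {c , d} =
    interleaved⇒cross ∘ interleaved-sym _ _ _ _ (ranks-apart (a ∷ c ∷ []) (b ∷ d ∷ [])) ∘ cross⇒interleaved

  cross-fan : ∀ {p q r s t} → Cross ε (p , q) (r , s) → Cross ε t (p , s) → Cross ε t (p , q) ⊎ Cross ε t (r , s)
  cross-fan {p} {q} {r} {s} {x , y} c₁ c₂ = Sum.map interleaved⇒cross interleaved⇒cross
    (interleaved-fan _ _ _ _ _ _ (ranks-apart (p ∷ r ∷ x ∷ []) (q ∷ s ∷ y ∷ []))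
      (cross⇒interleaved c₁) (cross⇒interleaved c₂))

  cross-fan′ : ∀ {p q r s t} → Cross ε (p , q) (r , s) → Cross ε t (r , q) → Cross ε t (p , q) ⊎ Cross ε t (r , s)
  cross-fan′ c₁ c₂ = Sum.swap (cross-fan (cross-sym c₁) c₂)

  cross-exchange : ∀ {p q r₁ s₁ r₂ s₂} → Cross ε (p , q) (r₁ , s₁) → Cross ε (p , q) (r₂ , s₂) →
                   ¬ Cross ε (r₁ , s₁) (r₂ , s₂) → (r₁ , s₁) ≢ (r₂ , s₂) →
                   Cross ε (p , s₁) (r₂ , s₂) ⊎ Cross ε (p , s₂) (r₁ , s₁) ⊎
                   Cross ε (r₁ , q) (r₂ , s₂) ⊎ Cross ε (r₂ , q) (r₁ , s₁)
  cross-exchange {p} {q} {r₁} {s₁} {r₂} {s₂} c₁ c₂ ¬c e₁≢e₂ =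
    Sum.map interleaved⇒cross (Sum.map interleaved⇒cross (Sum.map interleaved⇒cross interleaved⇒cross))
      (interleaved-exchange _ _ _ _ _ _ (ranks-apart (p ∷ r₁ ∷ r₂ ∷ []) (q ∷ s₁ ∷ s₂ ∷ []))
        (cross⇒interleaved c₁) (cross⇒interleaved c₂) (¬c ∘ interleaved⇒cross) endpoints-apart)
    where
    endpoints-apart : Apart (rankB ε r₁) (rankB ε r₂) ⊎ Apart (rankW ε s₁) (rankW ε s₂)
    endpoints-apart with r₁ Fin.≟ r₂
    ... | yes refl = inj₂ (≢⇒apart (λ eq → e₁≢e₂ (cong (r₁ ,_) (rankW-injective eq))))
    ... | no r₁≢r₂ = inj₁ (≢⇒apart (r₁≢r₂ ∘ rankB-injective))

  -- If s lay left of p, the vertical line through p would separate (r , s) from (p , q).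
  cross-overlap : ∀ {p q r s} → Cross ε (p , q) (r , s) → blackIdx p < whiteIdx q → blackIdx r < whiteIdx s →
                  blackIdx p < whiteIdx s
  cross-overlap {p} {q} {r} {s} (_ , _ , sides) p<q r<s with toℕ s <? toℕ p
  ... | no s≮p = s≤s (≮⇒≥ s≮p)
  ... | yes s<p = ⊥-elim ([ (λ (r-in , _) → not-inside p-band q-band r-out r-in)
                          , (λ (_ , s-in) → not-inside p-band q-band s-out s-in) ] sides)
    where
    p-band : Band (xB p) (rankB ε p)
    p-band = placed-right ≤-refl (xB≤M p) (rankB-placed p)
    q-band : Band (xB p) (rankW ε q)
    q-band = placed-right (≤-trans (*-monoʳ-≤ 2 (s≤s⁻¹ p<q)) (m≤m+n _ 1)) (xW≤M q) (rankW-placed q)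
    r-out : Outside (xB p) (rankB ε r)
    r-out = placed-left (*-monoʳ-< 2 (≤-<-trans (s≤s⁻¹ r<s) s<p)) (xB≤M p) (rankB-placed r)
    s-out : Outside (xB p) (rankW ε s)
    s-out = placed-left (odd<even s<p) (xB≤M p) (rankW-placed s)

  cross? : Decidable (Cross ε)
  cross? (a , b) (c , d) = map′ interleaved⇒cross cross⇒interleaved
    (interleaved? (rankB ε a) (rankW ε b) (rankB ε c) (rankW ε d))

module Forests {n : ℕ} (ε : SignVec n) (I J : Subset (suc n)) where
  open Complex ε I J
  open Geometry ε

  _≟ₑ_ : DecidableEquality (Edge n)
  _≟ₑ_ = ≡-dec Fin._≟_ Fin._≟_

  _∈ₑ?_ : (e : Edge n) (S : EdgeSet n) → Dec (e ∈ₑ S)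
  e ∈ₑ? S = S e Bool.≟ true

  ∃-edge? : {P : Pred (Edge n) 0ℓ} → U.Decidable P → Dec (∃ P)
  ∃-edge? P? = map′ (λ (a , b , p) → (a , b) , p) (λ ((a , b) , p) → a , b , p)
    (Fin.any? λ a → Fin.any? λ b → P? (a , b))

  allEdges : Vec (Edge n) (suc n * suc n)
  allEdges = allPairs (allFin (suc n)) (allFin (suc n))

  ∈-allEdges : ∀ e → e ∈ allEdges
  ∈-allEdges (a , b) = ∈-allPairs⁺ (∈-allFin⁺ a) (∈-allFin⁺ b)

  ∖-unfold : ∀ (T : EdgeSet n) δ e →
             (T ∖ₑ δ) e ≡ T e ∧ not (⌊ proj₁ e Fin.≟ proj₁ δ ⌋ ∧ ⌊ proj₂ e Fin.≟ proj₂ δ ⌋)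
  ∖-unfold T δ e = refl

  ∖-⊆ : ∀ {T δ} → (T ∖ₑ δ) ⊆ₑ T
  ∖-⊆ {T} {δ} e e∈T∖δ rewrite ∖-unfold T δ e with T e
  ... | true  = refl
  ... | false = e∈T∖δ

  ∖-≢ : ∀ {T δ e} → e ∈ₑ (T ∖ₑ δ) → e ≢ δ
  ∖-≢ {T} {δ} {e} e∈T∖δ refl rewrite ∖-unfold T e e with proj₁ e Fin.≟ proj₁ e | proj₂ e Fin.≟ proj₂ e
  ... | yes _ | yes _ = contradiction (trans (sym (∧-zeroʳ (T e))) e∈T∖δ) λ ()
  ... | no a≢a | _ = a≢a refl
  ... | yes _ | no b≢b = b≢b refl

  ∈-∖ : ∀ {T δ e} → e ∈ₑ T → e ≢ δ → e ∈ₑ (T ∖ₑ δ)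
  ∈-∖ {T} {c , d} {a , b} e∈T e≢δ rewrite ∖-unfold T (c , d) (a , b) | e∈T with a Fin.≟ c | b Fin.≟ d
  ... | yes refl | yes refl = contradiction refl e≢δ
  ... | yes _    | no _     = refl
  ... | no _     | _        = refl

  insert : Edge n → EdgeSet n → EdgeSet n
  insert e S x = ⌊ x ≟ₑ e ⌋ ∨ S x

  ∈-insert : ∀ {e S} → e ∈ₑ insert e S
  ∈-insert {e} with e ≟ₑ e
  ... | yes _   = refl
  ... | no e≢e = contradiction refl e≢e

  insert-⊇ : ∀ {e S} → S ⊆ₑ insert e S
  insert-⊇ {e} {S} x x∈S = trans (cong (⌊ x ≟ₑ e ⌋ ∨_) x∈S) (∨-zeroʳ ⌊ x ≟ₑ e ⌋)

  insert-∈ : ∀ {e S x} → x ∈ₑ insert e S → x ≡ e ⊎ x ∈ₑ S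
  insert-∈ {e} {S} {x} x∈ with x ≟ₑ e
  ... | yes x≡e = inj₁ x≡e
  ... | no _    = inj₂ x∈

  Compatible : EdgeSet n → Edge n → Set
  Compatible S e = ∀ t → t ∈ₑ S → ¬ Cross ε t e

  crossed? : ∀ S e → Dec (∃ λ t → t ∈ₑ S × Cross ε t e)
  crossed? S e = ∃-edge? λ t → (t ∈ₑ? S) ×-dec cross? t e

  compatible? : ∀ S e → Dec (Compatible S e)
  compatible? S e = map′ (λ ¬crossed t t∈S c → ¬crossed (t , t∈S , c)) (λ compat (t , t∈S , c) → compat t t∈S c)
    (¬? (crossed? S e))

  forest-insert : ∀ {S e} → Forest S → IsEdge I J e → Compatible S e → Forest (insert e S)
  forest-insert {S} {e} (edges , noncrossing) e-edge compat = edges′ , noncrossing′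
    where
    edges′ : ∀ x → x ∈ₑ insert e S → IsEdge I J x
    edges′ x x∈ with insert-∈ {S = S} x∈
    ... | inj₁ refl = e-edge
    ... | inj₂ x∈S  = edges x x∈S
    noncrossing′ : ∀ x y → x ∈ₑ insert e S → y ∈ₑ insert e S → ¬ Cross ε x y
    noncrossing′ x y x∈ y∈ with insert-∈ {S = S} x∈ | insert-∈ {S = S} y∈
    ... | inj₁ refl | inj₁ refl = cross-irrefl
    ... | inj₁ refl | inj₂ y∈S  = compat y y∈S ∘ cross-sym
    ... | inj₂ x∈S  | inj₁ refl = compat x x∈S
    ... | inj₂ x∈S  | inj₂ y∈S  = noncrossing x y x∈S y∈S

  tree-maximal : ∀ {T e} → Tree T → IsEdge I J e → Compatible T e → e ∈ₑ T
  tree-maximal {T} (forest , maximal) e-edge compat =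
    maximal (insert _ T) (forest-insert forest e-edge compat) (insert-⊇ {S = T}) _ (∈-insert {S = T})

  ≐ₑ-sym : ∀ {S S′ : EdgeSet n} → S ≐ₑ S′ → S′ ≐ₑ S
  ≐ₑ-sym = swap

  ≐ₑ-trans : ∀ {S S′ S″ : EdgeSet n} → S ≐ₑ S′ → S′ ≐ₑ S″ → S ≐ₑ S″
  ≐ₑ-trans (S⊆S′ , S′⊆S) (S′⊆S″ , S″⊆S′) = (λ e → S′⊆S″ e ∘ S⊆S′ e) , (λ e → S′⊆S e ∘ S″⊆S′ e)

  tree⊆forest⇒≐ : ∀ {T S} → Tree T → Forest S → T ⊆ₑ S → T ≐ₑ S
  tree⊆forest⇒≐ (_ , maximal) forest T⊆S = T⊆S , maximal _ forest T⊆S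

  ∖⊆⇒⊆ : ∀ {T S δ} → δ ∈ₑ S → (T ∖ₑ δ) ⊆ₑ S → T ⊆ₑ S
  ∖⊆⇒⊆ {T} {δ = δ} δ∈S T∖δ⊆S e e∈T with e ≟ₑ δ
  ... | yes refl = δ∈S
  ... | no e≢δ   = T∖δ⊆S e (∈-∖ {T} e∈T e≢δ)

  Within : Pred (Edge n) 0ℓ → EdgeSet n → Set
  Within P S = Forest S × (∀ e → e ∈ₑ S → P e)

  MaximalIn : Pred (Edge n) 0ℓ → EdgeSet n → Set
  MaximalIn P F = Within P F × (∀ e → P e → IsEdge I J e → Compatible F e → e ∈ₑ F)

  module Greedy {P : Pred (Edge n) 0ℓ} (P? : U.Decidable P) where

    Addable : EdgeSet n → Edge n → Set
    Addable S e = P e × IsEdge I J e × Compatible S e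

    addable? : ∀ S e → Dec (Addable S e)
    addable? S e = P? e ×-dec isEdge? e ×-dec compatible? S e
      where
      isEdge? : ∀ e → Dec (IsEdge I J e)
      isEdge? (b , w) = (b ∈? I) ×-dec (w ∈? J) ×-dec (blackIdx b <? whiteIdx w)

    step : ∀ {S e} → Dec (Addable S e) → EdgeSet n
    step {S} {e} (yes _) = insert e S
    step {S}     (no _)  = S

    greedy : ∀ {k} → Vec (Edge n) k → EdgeSet n → EdgeSet n
    greedy []       S = S
    greedy (e ∷ es) S = greedy es (step (addable? S e))

    step-within : ∀ {S e} (a? : Dec (Addable S e)) → Within P S → Within P (step a?)
    step-within {S} (yes (pe , e-edge , compat)) (forest , inP) = forest-insert forest e-edge compat , inP′
      where
      inP′ : ∀ x → x ∈ₑ insert _ S → P x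
      inP′ x x∈ with insert-∈ {S = S} x∈
      ... | inj₁ refl = pe
      ... | inj₂ x∈S  = inP x x∈S
    step-within (no _) within = within

    step-⊇ : ∀ {S e} (a? : Dec (Addable S e)) → S ⊆ₑ step a?
    step-⊇ {S} (yes _) = insert-⊇ {S = S}
    step-⊇     (no _)  _ x∈S = x∈S

    greedy-within : ∀ {k} (es : Vec (Edge n) k) {S} → Within P S → Within P (greedy es S)
    greedy-within []       within = within
    greedy-within (e ∷ es) {S} within = greedy-within es (step-within (addable? S e) within)

    greedy-⊇ : ∀ {k} (es : Vec (Edge n) k) {S} → S ⊆ₑ greedy es S
    greedy-⊇ []       _ x∈S = x∈S
    greedy-⊇ (e ∷ es) {S} x x∈S = greedy-⊇ es x (step-⊇ (addable? S e) x x∈S)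

    -- An edge rejected at its turn stays incompatible, since the set only grows afterwards.
    greedy-maximal : ∀ {k} (es : Vec (Edge n) k) {S e} → e ∈ es → P e → IsEdge I J e →
                     Compatible (greedy es S) e → e ∈ₑ greedy es S
    greedy-maximal (e ∷ es) {S} (here refl) pe e-edge compat with addable? S e
    ... | yes _       = greedy-⊇ es e (∈-insert {S = S})
    ... | no ¬addable = contradiction (pe , e-edge , λ t t∈S → compat t (greedy-⊇ es t t∈S)) ¬addable
    greedy-maximal (x ∷ es) {S} (there e∈es) pe e-edge compat =
      greedy-maximal es e∈es pe e-edge compat

    extend-within : ∀ {F} → Within P F → ∃ λ F′ → F ⊆ₑ F′ × MaximalIn P F′
    extend-within {F} within =
      greedy allEdges F , greedy-⊇ allEdges , greedy-within allEdges within ,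
      λ e pe e-edge compat → greedy-maximal allEdges (∈-allEdges e) pe e-edge compat

  extend-to-tree : ∀ {F} → Forest F → ∃ λ T → F ⊆ₑ T × Tree T
  extend-to-tree forest with Greedy.extend-within (λ _ → yes tt) (forest , λ _ _ → tt)
  ... | T , F⊆T , (forestT , _) , maximal =
    T , F⊆T , forestT , λ S (edges , noncrossing) T⊆S e e∈S →
      maximal e tt (edges e e∈S) (λ t t∈T → noncrossing t e (T⊆S t t∈T) e∈S)

  module AfterRemoving {T T′ : EdgeSet n} {p q : Fin (suc n)} (tree : Tree T) (δ∈T : (p , q) ∈ₑ T)
                  (forest′ : Forest T′) (T∖δ⊆T′ : (T ∖ₑ (p , q)) ⊆ₑ T′) where

    δ : Edge n
    δ = p , q

    new-edge-crosses : ∀ {e} → e ∈ₑ T′ → ¬ e ∈ₑ T → Cross ε δ e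
    new-edge-crosses {e} e∈T′ e∉T with cross? δ e
    ... | yes c  = c
    ... | no ¬c = contradiction (tree-maximal tree (proj₁ forest′ e e∈T′) compat) e∉T
      where
      compat : Compatible T e
      compat t t∈T with t ≟ₑ δ
      ... | yes refl = ¬c
      ... | no t≢δ   = proj₂ forest′ t e (T∖δ⊆T′ t (∈-∖ {T} t∈T t≢δ)) e∈T′

    blocked-edge-absurd : ∀ {g k o} → IsEdge I J g → g ≢ δ → ¬ Cross ε δ g →
                          (∀ {t} → Cross ε t g → Cross ε t δ ⊎ Cross ε t k) →
                          k ∈ₑ T′ → o ∈ₑ T′ → Cross ε g o → ⊥
    blocked-edge-absurd {g} {k} {o} g-edge g≢δ δ∦g blockers k∈T′ o∈T′ g×o with g ∈ₑ? T
    ... | yes g∈T = proj₂ forest′ g o (T∖δ⊆T′ g (∈-∖ {T} g∈T g≢δ)) o∈T′ g×o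
    ... | no g∉T with crossed? T g
    ...   | no ¬crossed = g∉T (tree-maximal tree g-edge λ t t∈T c → ¬crossed (t , t∈T , c))
    ...   | yes (t , t∈T , t×g) = [ proj₂ (proj₁ tree) t δ t∈T δ∈T
                            , proj₂ forest′ t k (T∖δ⊆T′ t (∈-∖ {T} t∈T t≢δ)) k∈T′ ] (blockers t×g)
      where
      t≢δ : t ≢ δ
      t≢δ refl = δ∦g t×g

    δ-edge : IsEdge I J δ
    δ-edge = proj₁ (proj₁ tree) δ δ∈T

    via-black-end : ∀ {r s e} → Cross ε δ (r , s) → (r , s) ∈ₑ T′ → e ∈ₑ T′ → Cross ε (p , s) e → ⊥
    via-black-end {r} {s} c k∈T′ e∈T′ = blocked-edge-absurd
      (proj₁ δ-edge , proj₁ (proj₂ k-edge) , cross-overlap c (proj₂ (proj₂ δ-edge)) (proj₂ (proj₂ k-edge)))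
      (λ { refl → proj₁ (proj₂ c) refl }) (λ c′ → proj₁ c′ refl) (cross-fan c) k∈T′ e∈T′
      where
      k-edge : IsEdge I J (r , s)
      k-edge = proj₁ forest′ _ k∈T′

    via-white-end : ∀ {r s e} → Cross ε δ (r , s) → (r , s) ∈ₑ T′ → e ∈ₑ T′ → Cross ε (r , q) e → ⊥
    via-white-end {r} {s} c k∈T′ e∈T′ = blocked-edge-absurd
      (proj₁ k-edge , proj₁ (proj₂ δ-edge) , cross-overlap (cross-sym c) (proj₂ (proj₂ k-edge)) (proj₂ (proj₂ δ-edge)))
      (λ { refl → proj₁ c refl }) (λ c′ → proj₁ (proj₂ c′) refl) (cross-fan′ c) k∈T′ e∈T′
      where
      k-edge : IsEdge I J (r , s)
      k-edge = proj₁ forest′ _ k∈T′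

    at-most-one-new-edge : ∀ {e₁ e₂} → e₁ ∈ₑ T′ → e₂ ∈ₑ T′ → ¬ e₁ ∈ₑ T → ¬ e₂ ∈ₑ T → e₁ ≡ e₂
    at-most-one-new-edge {e₁} {e₂} e₁∈T′ e₂∈T′ e₁∉T e₂∉T with e₁ ≟ₑ e₂
    ... | yes e₁≡e₂ = e₁≡e₂
    ... | no e₁≢e₂ = ⊥-elim
      ([ via-black-end c₁ e₁∈T′ e₂∈T′ , [ via-black-end c₂ e₂∈T′ e₁∈T′
       , [ via-white-end c₁ e₁∈T′ e₂∈T′ , via-white-end c₂ e₂∈T′ e₁∈T′ ] ] ]
       (cross-exchange c₁ c₂ (proj₂ forest′ e₁ e₂ e₁∈T′ e₂∈T′) e₁≢e₂))
      where
      c₁ : Cross ε δ e₁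
      c₁ = new-edge-crosses e₁∈T′ e₁∉T
      c₂ : Cross ε δ e₂
      c₂ = new-edge-crosses e₂∈T′ e₂∉T

  unflippable⇒unique-tree : ∀ {T δ} → Tree T → δ ∈ₑ T → Unflippable T δ →
                            ∀ T′ → Tree T′ → (T ∖ₑ δ) ⊆ₑ T′ → T′ ≐ₑ T
  unflippable⇒unique-tree {T} {δ} tree δ∈T unflippable T′ tree′ T∖δ⊆T′ with δ ∈ₑ? T′
  ... | yes δ∈T′ = ≐ₑ-sym (tree⊆forest⇒≐ tree (proj₁ tree′) (∖⊆⇒⊆ {T} δ∈T′ T∖δ⊆T′))
  ... | no δ∉T′ with ∃-edge? (λ e → (e ∈ₑ? T′) ×-dec ¬? (e ∈ₑ? T))
  ...   | no ¬new = tree⊆forest⇒≐ tree′ (proj₁ tree) λ e e∈T′ →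
    decidable-stable (e ∈ₑ? T) (λ e∉T → ¬new (e , e∈T′ , e∉T))
  ...   | yes (δ′ , δ′∈T′ , δ′∉T) =
    contradiction (T′ , δ′ , tree′ , T′≉T , δ′∈T′ , T∖δ⊆T′∖δ′ , T′∖δ′⊆T∖δ) unflippable
    where
    open AfterRemoving tree δ∈T (proj₁ tree′) T∖δ⊆T′ using (at-most-one-new-edge)
    T′≉T : ¬ (T′ ≐ₑ T)
    T′≉T (T′⊆T , _) = δ′∉T (T′⊆T δ′ δ′∈T′)
    T∖δ⊆T′∖δ′ : (T ∖ₑ δ) ⊆ₑ (T′ ∖ₑ δ′)
    T∖δ⊆T′∖δ′ e e∈ = ∈-∖ {T′} (T∖δ⊆T′ e e∈) λ { refl → δ′∉T (∖-⊆ {T} e e∈) }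
    T′∖δ′⊆T∖δ : (T′ ∖ₑ δ′) ⊆ₑ (T ∖ₑ δ)
    T′∖δ′⊆T∖δ e e∈ with e ∈ₑ? T
    ... | yes e∈T = ∈-∖ {T} e∈T λ { refl → δ∉T′ (∖-⊆ {T′} e e∈) }
    ... | no e∉T  = contradiction (at-most-one-new-edge (∖-⊆ {T′} e e∈) δ′∈T′ e∉T δ′∉T) (∖-≢ {T′} e∈)

  unflippable⇒onBoundary : ∀ {F T δ} → Tree T → δ ∈ₑ T → Unflippable T δ → F ⊆ₑ (T ∖ₑ δ) → OnBoundary F
  unflippable⇒onBoundary {T = T} {δ} tree δ∈T unflippable F⊆T∖δ =
    T ∖ₑ δ , (T , δ , tree , δ∈T , (λ _ h → h) , (λ _ h → h)) ,
    (T , tree , ∖-⊆ {T} , unflippable⇒unique-tree tree δ∈T unflippable) , F⊆T∖δ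

  onBoundary⇒unflippable : ∀ {F} → OnBoundary F →
                           ∃ λ T → ∃ λ δ → Tree T × δ ∈ₑ T × Unflippable T δ × F ⊆ₑ (T ∖ₑ δ)
  onBoundary⇒unflippable (C , (T , δ , tree , δ∈T , C⊆T∖δ , _) , (_ , _ , _ , unique) , F⊆C) =
    T , δ , tree , δ∈T , unflippable , λ e e∈F → C⊆T∖δ e (F⊆C e e∈F)
    where
    unflippable : Unflippable T δ
    unflippable (T′ , _ , tree′ , T′≉T , _ , T∖δ⊆T′∖δ′ , _) =
      T′≉T (≐ₑ-trans (unique T′ tree′ C⊆T′) (≐ₑ-sym (unique T tree C⊆T)))
      where
      C⊆T : C ⊆ₑ T
      C⊆T e e∈C = ∖-⊆ {T} e (C⊆T∖δ e e∈C)
      C⊆T′ : C ⊆ₑ T′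
      C⊆T′ e e∈C = ∖-⊆ {T′} e (T∖δ⊆T′∖δ′ e (C⊆T∖δ e e∈C))

  crossings : EdgeSet n → Edge n → ℕ
  crossings T e = count (λ t → (t ∈ₑ? T) ×-dec cross? t e) allEdges

  Detour : EdgeSet n → Pred (Edge n) 0ℓ → Set
  Detour T Q = ∀ {e t} → Q e → IsEdge I J e → t ∈ₑ T → Cross ε t e →
               ∃ λ e′ → Q e′ × IsEdge I J e′ × ¬ Cross ε t e′ × (∀ {t′} → t′ ∈ₑ T → Cross ε t′ e′ → Cross ε t′ e)

  tree-meets : ∀ {T Q e} → Tree T → Detour T Q → Q e → IsEdge I J e → ∃ λ e′ → e′ ∈ₑ T × Q e′
  tree-meets {T} {Q} {e} tree detour = go e (<-wellFounded (crossings T e))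
    where
    go : ∀ e → Acc _<_ (crossings T e) → Q e → IsEdge I J e → ∃ λ e′ → e′ ∈ₑ T × Q e′
    go e (acc smaller) qe e-edge with crossed? T e
    ... | no ¬crossed = e , tree-maximal tree e-edge (λ t t∈T c → ¬crossed (t , t∈T , c)) , qe
    ... | yes (t , t∈T , t×e) with detour qe e-edge t∈T t×e
    ...   | e′ , qe′ , e′-edge , t∦e′ , fewer = go e′ (smaller fewer-crossings) qe′ e′-edge
      where
      fewer-crossings : crossings T e′ < crossings T e
      fewer-crossings = count-mono-strict (λ x → (x ∈ₑ? T) ×-dec cross? x e′) (λ x → (x ∈ₑ? T) ×-dec cross? x e)
        (λ (t′∈T , c) → t′∈T , fewer t′∈T c) (∈-allEdges t) (λ (_ , c) → t∦e′ c) (t∈T , t×e)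

  black-detour : ∀ {T i} → Tree T → Detour T (λ e → proj₁ e ≡ i)
  black-detour (forest , _) {i , w} {a , b} refl (i∈I , _ , i<w) t∈T t×e
    with proj₁ forest _ t∈T
  ... | _ , b∈J , a<b =
    (i , b) , refl , (i∈I , b∈J , cross-overlap (cross-sym t×e) i<w a<b) , (λ c → proj₁ (proj₂ c) refl) ,
    λ t′∈T c → [ (λ c′ → c′) , (λ c′ → contradiction c′ (proj₂ forest _ _ t′∈T t∈T)) ] (cross-fan (cross-sym t×e) c)

  white-detour : ∀ {T j} → Tree T → Detour T (λ e → proj₂ e ≡ j)
  white-detour (forest , _) {a₀ , j} {a , b} refl (_ , j∈J , a₀<j) t∈T t×e
    with proj₁ forest _ t∈T
  ... | a∈I , _ , a<b =
    (a , j) , refl , (a∈I , j∈J , cross-overlap t×e a<b a₀<j) , (λ c → proj₁ c refl) ,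
    λ t′∈T c → [ (λ c′ → c′) , (λ c′ → contradiction c′ (proj₂ forest _ _ t′∈T t∈T)) ] (cross-fan′ (cross-sym t×e) c)

  module _ {Q : Pred (Edge n) 0ℓ} (Q? : U.Decidable Q) (Q-noncrossing : ∀ {e f} → Q e → Q f → ¬ Cross ε e f) where

    Q-edge-unflippable : ∀ {F T δ} → MaximalIn (¬_ ∘ Q) F → Tree T → F ⊆ₑ T → δ ∈ₑ T → Q δ → Unflippable T δ
    Q-edge-unflippable {F} {T} {δ} ((_ , F-avoids) , F-maximal) tree F⊆T δ∈T qδ
                     (T′ , δ′ , tree′ , T′≉T , δ′∈T′ , T∖δ⊆T′∖δ′ , T′∖δ′⊆T∖δ) with δ′ ∈ₑ? T
    ... | yes δ′∈T = T′≉T (tree⊆forest⇒≐ tree′ (proj₁ tree) (∖⊆⇒⊆ {T′} δ′∈T λ e e∈ → ∖-⊆ {T} e (T′∖δ′⊆T∖δ e e∈)))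
    ... | no δ′∉T with Q? δ′
    ...   | yes qδ′ = δ′∉T (tree-maximal tree δ′-edge compatible)
      where
      compatible : Compatible T δ′
      compatible t t∈T with t ≟ₑ δ
      ... | yes refl = Q-noncrossing qδ qδ′
      ... | no t≢δ   = proj₂ (proj₁ tree′) t δ′ (∖-⊆ {T′} t (T∖δ⊆T′∖δ′ t (∈-∖ {T} t∈T t≢δ))) δ′∈T′
      δ′-edge : IsEdge I J δ′
      δ′-edge = proj₁ (proj₁ tree′) δ′ δ′∈T′
    ...   | no ¬qδ′ = δ′∉T (F⊆T δ′ (F-maximal δ′ ¬qδ′ δ′-edge compatible))
      where
      compatible : Compatible F δ′
      compatible t t∈F = proj₂ (proj₁ tree′) t δ′
        (∖-⊆ {T′} t (T∖δ⊆T′∖δ′ t (∈-∖ {T} (F⊆T t t∈F) λ { refl → F-avoids t t∈F qδ }))) δ′∈T′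
      δ′-edge : IsEdge I J δ′
      δ′-edge = proj₁ (proj₁ tree′) δ′ δ′∈T′

    onBoundary-avoiding : ∀ {F} → Forest F → (∀ e → e ∈ₑ F → ¬ Q e) → (∀ {T} → Tree T → ∃ λ δ → δ ∈ₑ T × Q δ) →
                          OnBoundary F
    onBoundary-avoiding forest F-avoids meets with Greedy.extend-within (¬? ∘ Q?) (forest , F-avoids)
    ... | F′ , F⊆F′ , maximal′ with extend-to-tree (proj₁ (proj₁ maximal′))
    ...   | T , F′⊆T , tree with meets tree
    ...     | δ , δ∈T , qδ = unflippable⇒onBoundary tree δ∈T (Q-edge-unflippable maximal′ tree F′⊆T δ∈T qδ)
      λ e e∈F → ∈-∖ {T} (F′⊆T e (F⊆F′ e e∈F)) λ { refl → F-avoids e e∈F qδ }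

  onBoundary-missing-irrelevant : ∀ {F δ} → Forest F → Irrelevant δ → ¬ δ ∈ₑ F → OnBoundary F
  onBoundary-missing-irrelevant {δ = δ} forest (δ-edge , irrelevant) δ∉F =
    onBoundary-avoiding (_≟ₑ δ) (λ { refl refl → cross-irrefl }) forest (λ { e e∈F refl → δ∉F e∈F })
      λ tree → δ , tree-maximal tree δ-edge (λ t t∈T → irrelevant t (proj₁ (proj₁ tree) t t∈T)) , refl

  onBoundary-isolated-black : ∀ {F i} → Admissible I J → Forest F → i Subset.∈ I → (∀ e → e ∈ₑ F → proj₁ e ≢ i) →
                              OnBoundary F
  onBoundary-isolated-black {i = i} (_ , _ , _ , j , j∈J , below-j) forest i∈I isolated =
    onBoundary-avoiding (λ e → proj₁ e Fin.≟ i) (λ e≡i f≡i c → proj₁ c (trans e≡i (sym f≡i))) forest isolated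
      λ tree → tree-meets tree (black-detour tree) refl (i∈I , j∈J , below-j i i∈I)

  onBoundary-isolated-white : ∀ {F j} → Admissible I J → Forest F → j Subset.∈ J → (∀ e → e ∈ₑ F → proj₂ e ≢ j) →
                              OnBoundary F
  onBoundary-isolated-white {j = j} (_ , _ , (i , i∈I , below-J) , _) forest j∈J isolated =
    onBoundary-avoiding (λ e → proj₂ e Fin.≟ j) (λ e≡j f≡j c → proj₁ (proj₂ c) (trans e≡j (sym f≡j))) forest isolated
      λ tree → tree-meets tree (white-detour tree) refl (i∈I , j∈J , below-J j j∈J)

lemma1p4 : (n : ℕ) → 1 Data.Nat.≤ n → (ε : SignVec n) → (I J : Subset (Data.Nat.suc n)) → Admissible I J →
    let open Complex ε I J in
      (∀ F → Forest F → (OnBoundary F ⇔ (∃[ T ] ∃[ δ ] (Tree T × δ ∈ₑ T × Unflippable T δ × F ⊆ₑ (T ∖ₑ δ)))))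
    × (∀ F → Forest F → ((∃[ δ ] (Irrelevant δ × ¬ (δ ∈ₑ F))) ⊎ HasIsolatedVertex F) → OnBoundary F)
lemma1p4 n _ ε I J admissible =
  (λ F _ → mk⇔ onBoundary⇒unflippable λ (_ , _ , tree , δ∈T , unflippable , F⊆T∖δ) →
             unflippable⇒onBoundary tree δ∈T unflippable F⊆T∖δ) ,
  λ where
    _ forest (inj₁ (_ , irrelevant , δ∉F))      → onBoundary-missing-irrelevant forest irrelevant δ∉F
    _ forest (inj₂ (inj₁ (_ , i∈I , isolated))) → onBoundary-isolated-black admissible forest i∈I isolated
    _ forest (inj₂ (inj₂ (_ , j∈J , isolated))) → onBoundary-isolated-white admissible forest j∈J isolated
  where
  open Forests ε I J
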